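{- Let $n$ be odd. Any $n\times n$ matrix with entries in $\{ -1,1\}$ can be converted, by a sequence of negations of rows and of columns, into a parity normalized matrix, and the parity normalized matrix so obtainable is unique.
   Context: A vector of odd length with entries in $\{ -1,1\}$ is parity normalized if it has an even number of entries equal to $+1$. A $\{ -1,1\}$-matrix of odd order is parity normalized if all its rows and all its columns are parity normalized. -}

module Defs where

open import Data.Nat using (ℕ; zero; suc)
open import Data.Nat.Base using (_%_)
open import Data.Fin using (Fin)
import Data.Fin as Fin
open import Data.Sign using (Sign; +; -; opposite)
open import Data.Bool using (Bool; true; false; if_then_else_)
open import Relation.Binary.PropositionalEquality using (_≡_)
open import Relation.Binary.Construct.Closure.ReflexiveTransitive using (Star)
open import Relation.Nullary.Decidable using (⌊_⌋)
open import Data.Fin using (_≟_)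

-- A {-1,1}-vector of length n: entries are signs (+ ↔ +1, - ↔ -1).
SignVec : ℕ → Set
SignVec n = Fin n → Sign

SignMatrix : ℕ → Set
SignMatrix n = Fin n → Fin n → Sign

countPlus : ∀ {n} → SignVec n → ℕ
countPlus {zero}  v = zero
countPlus {suc n} v with v Fin.zero
... | + = suc (countPlus (λ i → v (Fin.suc i)))
... | - = countPlus (λ i → v (Fin.suc i))

Even : ℕ → Set
Even k = k % 2 ≡ 0

Odd : ℕ → Set
Odd k = k % 2 ≡ 1

ParityNormalizedVec : ∀ {n} → SignVec n → Set
ParityNormalizedVec v = Even (countPlus v)

ParityNormalized : ∀ {n} → SignMatrix n → Set
ParityNormalized {n} M =
  (∀ i → ParityNormalizedVec (λ j → M i j)) × (∀ j → ParityNormalizedVec (λ i → M i j))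
  where open import Data.Product using (_×_)

negateRow : ∀ {n} → Fin n → SignMatrix n → SignMatrix n
negateRow r M i j = if ⌊ i ≟ r ⌋ then opposite (M i j) else M i j

negateCol : ∀ {n} → Fin n → SignMatrix n → SignMatrix n
negateCol c M i j = if ⌊ j ≟ c ⌋ then opposite (M i j) else M i j

data NegStep {n : ℕ} (M N : SignMatrix n) : Set where
  rowStep : (r : Fin n) → (∀ i j → N i j ≡ negateRow r M i j) → NegStep M N
  colStep : (c : Fin n) → (∀ i j → N i j ≡ negateCol c M i j) → NegStep M N

Obtainable : ∀ {n} → SignMatrix n → SignMatrix n → Set
Obtainable = Star NegStep

{-# OPTIONS --safe #-}
module Submission where

-- Over GF(2), read through the indicator plusParity of the entries +1, a line is parity
-- normalized iff its sum vanishes. Sequences of row and column negations realise exactly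
-- the patterns "negate entry (i, j) iff a i + b j = 1", and since n is odd such a pattern
-- adds a i + ∑ b to the parity of row i and b j + ∑ a to that of column j.
-- Existence: taking a = the row parities and b = the column parities plus the total parity
-- clears every line. Uniqueness: between two normalized matrices every a i equals ∑ b and
-- every b j equals ∑ a = n ∑ b = ∑ b, so a i + b j = 0 and the pattern is trivial.

open import Defs
open import Data.Nat using (ℕ)
open import Data.Product using (Σ; _×_)
open import Relation.Binary.PropositionalEquality using (_≡_)

open import Data.Nat.Base using (zero; suc; parity)
open import Data.Bool.Base using (if_then_else_)
open import Data.Fin.Base using (Fin; zero; suc)
open import Data.Fin.Properties using (_≟_)
open import Data.Product using (_,_; proj₁; proj₂; ∃₂; Σ-syntax)
open import Data.Sign.Base as 𝕊 using (Sign; _*_)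
open import Data.Sign.Properties using () renaming (*-assoc to *-assoc-sign)
open import Data.Parity.Base as ℙ using (Parity; 0ℙ; 1ℙ; _+_; _⁻¹; toSign)
open import Data.Parity.Properties
  using ( +-identityʳ; +-assoc; +-comm; p+p≡0ℙ; *-identityʳ; *-zeroʳ; +-homo-*
        ; suc-homo-⁻¹; ⁻¹-selfInverse; +-commutativeSemigroup; +-0-commutativeMonoid; +-0-group)
open import Algebra.Properties.CommutativeMonoid.Sum +-0-commutativeMonoid
  using (sum; sum-syntax; sum-cong-≗; sum-replicate-zero; ∑-distrib-+; ∑-comm)
open import Algebra.Properties.CommutativeSemigroup +-commutativeSemigroup using (interchange)
open import Algebra.Properties.Group +-0-group using (x∙y⁻¹≈ε⇒x≈y)
open import Function.Base using (flip; _∘_)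
open import Function.Bundles using (_⇔_; mk⇔; Equivalence)
open import Relation.Binary.PropositionalEquality using (refl; sym; trans; cong; cong₂; module ≡-Reasoning)
open import Relation.Binary.Construct.Closure.ReflexiveTransitive using (ε; _◅_; _◅◅_; gmap)
open import Relation.Nullary.Decidable using (does; yes; no)

open Equivalence using (to; from)
open ≡-Reasoning

plusParity : Sign → Parity
plusParity 𝕊.- = 0ℙ
plusParity 𝕊.+ = 1ℙ

plusParity-toSign* : ∀ p s → plusParity (toSign p * s) ≡ p + plusParity s
plusParity-toSign* 0ℙ s = refl
plusParity-toSign* 1ℙ 𝕊.- = refl
plusParity-toSign* 1ℙ 𝕊.+ = refl

toSign-+-* : ∀ p q s → toSign p * (toSign q * s) ≡ toSign (p + q) * s
toSign-+-* p q s = begin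
  toSign p * (toSign q * s) ≡⟨ *-assoc-sign (toSign p) (toSign q) s ⟨
  toSign p * toSign q * s   ≡⟨ cong (_* s) (+-homo-* p q) ⟨
  toSign (p + q) * s        ∎

toSign-*-involutive : ∀ p s → toSign p * (toSign p * s) ≡ s
toSign-*-involutive p s = trans (toSign-+-* p p s) (cong (λ q → toSign q * s) (p+p≡0ℙ p))

∑-replicate : ∀ m x → ∑[ k < m ] x ≡ parity m ℙ.* x
∑-replicate zero          x = refl
∑-replicate (suc zero)    x = +-identityʳ x
∑-replicate (suc (suc m)) x = begin
  x + (x + ∑[ k < m ] x) ≡⟨ +-assoc x x _ ⟨
  (x + x) + ∑[ k < m ] x ≡⟨ cong (_+ ∑[ k < m ] x) (p+p≡0ℙ x) ⟩
  ∑[ k < m ] x           ≡⟨ ∑-replicate m x ⟩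
  parity m ℙ.* x         ∎

basis : ∀ {n} → Fin n → Fin n → Parity
basis r i = if does (i ≟ r) then 1ℙ else 0ℙ

∑-basis : ∀ {n} (c : Fin n → Parity) i → ∑[ k < n ] (c k ℙ.* basis k i) ≡ c i
∑-basis {suc n} c zero = begin
  c zero ℙ.* 1ℙ + ∑[ k < n ] (c (suc k) ℙ.* 0ℙ) ≡⟨ cong₂ _+_ (*-identityʳ (c zero)) (sum-cong-≗ (*-zeroʳ ∘ c ∘ suc)) ⟩
  c zero + ∑[ k < n ] 0ℙ                        ≡⟨ cong (c zero +_) (sum-replicate-zero n) ⟩
  c zero + 0ℙ                                   ≡⟨ +-identityʳ (c zero) ⟩
  c zero                                        ∎
∑-basis {suc n} c (suc i) = cong₂ _+_ (*-zeroʳ (c zero)) (∑-basis (c ∘ suc) i)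

parity-suc : ∀ k → parity (suc k) ≡ parity k ⁻¹
parity-suc k = sym (⁻¹-selfInverse (suc-homo-⁻¹ k))

even⇒parity≡0ℙ : ∀ k → Even k → parity k ≡ 0ℙ
even⇒parity≡0ℙ zero          _      = refl
even⇒parity≡0ℙ (suc (suc k)) k-even = even⇒parity≡0ℙ k k-even

parity≡0ℙ⇒even : ∀ k → parity k ≡ 0ℙ → Even k
parity≡0ℙ⇒even zero          _ = refl
parity≡0ℙ⇒even (suc (suc k)) p = parity≡0ℙ⇒even k p

odd⇒parity≡1ℙ : ∀ k → Odd k → parity k ≡ 1ℙ
odd⇒parity≡1ℙ (suc zero)    _     = refl
odd⇒parity≡1ℙ (suc (suc k)) k-odd = odd⇒parity≡1ℙ k k-odd

parity-countPlus : ∀ {n} (v : SignVec n) → parity (countPlus v) ≡ ∑[ j < n ] plusParity (v j)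
parity-countPlus {zero}  v = refl
parity-countPlus {suc n} v with v zero
... | 𝕊.+ = trans (parity-suc (countPlus (v ∘ suc))) (cong _⁻¹ (parity-countPlus (v ∘ suc)))
... | 𝕊.- = parity-countPlus (v ∘ suc)

parityNormalizedVec⇔ : ∀ {n} (v : SignVec n) →
  ParityNormalizedVec v ⇔ (∑[ j < n ] plusParity (v j) ≡ 0ℙ)
parityNormalizedVec⇔ v = mk⇔
  (λ even → trans (sym (parity-countPlus v)) (even⇒parity≡0ℙ (countPlus v) even))
  (λ ∑≡0 → parity≡0ℙ⇒even (countPlus v) (trans (parity-countPlus v) ∑≡0))

rowParity : ∀ {n} → SignMatrix n → Fin n → Parity
rowParity {n} M i = ∑[ j < n ] plusParity (M i j)

RowsEven : ∀ {n} → SignMatrix n → Set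
RowsEven M = ∀ i → rowParity M i ≡ 0ℙ

parityNormalized⇔ : ∀ {n} (M : SignMatrix n) → ParityNormalized M ⇔ (RowsEven M × RowsEven (flip M))
parityNormalized⇔ M = mk⇔
  (λ (rows , cols) → (λ i → to (row⇔ i) (rows i)) , (λ j → to (col⇔ j) (cols j)))
  (λ (rows , cols) → (λ i → from (row⇔ i) (rows i)) , (λ j → from (col⇔ j) (cols j)))
  where
  row⇔ = λ i → parityNormalizedVec⇔ (M i)
  col⇔ = λ j → parityNormalizedVec⇔ (flip M j)

record LinesNegated {n} (a b : Fin n → Parity) (M N : SignMatrix n) : Set where
  constructor linesNegated
  field
    entries : ∀ i j → N i j ≡ toSign (a i + b j) * M i j

open LinesNegated

module _ {n : ℕ} where

  linesNegated-refl : {M : SignMatrix n} → LinesNegated (λ _ → 0ℙ) (λ _ → 0ℙ) M M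
  linesNegated-refl .entries i j = refl

  linesNegated-sym : ∀ {a b} {M N : SignMatrix n} → LinesNegated a b M N → LinesNegated a b N M
  linesNegated-sym {a} {b} {M} {N} M~N .entries i j = begin
    M i j                                             ≡⟨ toSign-*-involutive (a i + b j) (M i j) ⟨
    toSign (a i + b j) * (toSign (a i + b j) * M i j) ≡⟨ cong (toSign (a i + b j) *_) (entries M~N i j) ⟨
    toSign (a i + b j) * N i j                        ∎

  linesNegated-trans : ∀ {a b a′ b′} {L M N : SignMatrix n} →
    LinesNegated a b L M → LinesNegated a′ b′ M N → LinesNegated (λ i → a′ i + a i) (λ j → b′ j + b j) L N
  linesNegated-trans {a} {b} {a′} {b′} {L} {M} {N} L~M M~N .entries i j = begin
    N i j                                               ≡⟨ entries M~N i j ⟩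
    toSign (a′ i + b′ j) * M i j                        ≡⟨ cong (toSign (a′ i + b′ j) *_) (entries L~M i j) ⟩
    toSign (a′ i + b′ j) * (toSign (a i + b j) * L i j) ≡⟨ toSign-+-* (a′ i + b′ j) (a i + b j) (L i j) ⟩
    toSign ((a′ i + b′ j) + (a i + b j)) * L i j        ≡⟨ cong (λ p → toSign p * L i j) (interchange (a′ i) (b′ j) (a i) (b j)) ⟩
    toSign ((a′ i + a i) + (b′ j + b j)) * L i j        ∎

  linesNegated-flip : ∀ {a b} {M N : SignMatrix n} → LinesNegated a b M N → LinesNegated b a (flip M) (flip N)
  linesNegated-flip {a} {b} {M} M~N .entries j i = trans (entries M~N i j) (cong (λ p → toSign p * M i j) (+-comm (a i) (b j)))

  negateRow≡toSign* : ∀ r (M : SignMatrix n) i j → negateRow r M i j ≡ toSign (basis r i) * M i j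
  negateRow≡toSign* r M i j with i ≟ r
  ... | yes _ = refl
  ... | no _  = refl

  negStep⇒linesNegated : {M N : SignMatrix n} → NegStep M N → ∃₂ λ a b → LinesNegated a b M N
  negStep⇒linesNegated {M} (rowStep r N≡) = basis r , (λ _ → 0ℙ) , linesNegated λ i j →
    trans (N≡ i j) (trans (negateRow≡toSign* r M i j) (cong (λ p → toSign p * M i j) (sym (+-identityʳ (basis r i)))))
  negStep⇒linesNegated {M} (colStep c N≡) = (λ _ → 0ℙ) , basis c , linesNegated λ i j →
    trans (N≡ i j) (negateRow≡toSign* c (flip M) j i)

  obtainable⇒linesNegated : {M N : SignMatrix n} → Obtainable M N → ∃₂ λ a b → LinesNegated a b M N
  obtainable⇒linesNegated ε = (λ _ → 0ℙ) , (λ _ → 0ℙ) , linesNegated-refl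
  obtainable⇒linesNegated (step ◅ steps) =
    let _ , _ , L~M = negStep⇒linesNegated step
        _ , _ , M~N = obtainable⇒linesNegated steps
    in  _ , _ , linesNegated-trans L~M M~N

  obtainable-flip : {M N : SignMatrix n} → Obtainable M N → Obtainable (flip M) (flip N)
  obtainable-flip = gmap flip negStep-flip
    where
    negStep-flip : {M N : SignMatrix n} → NegStep M N → NegStep (flip M) (flip N)
    negStep-flip (rowStep r N≡) = colStep r (flip N≡)
    negStep-flip (colStep c N≡) = rowStep c (flip N≡)

  rowsNegated-obtainable : ∀ (a : Fin n → Parity) (M : SignMatrix n) →
    Σ[ N ∈ SignMatrix n ] Obtainable M N × (∀ i j → N i j ≡ toSign (a i) * M i j)
  rowsNegated-obtainable a M =
    let N , M⇝N , N≡ = familyNegated-obtainable (λ k → k) a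
    in  N , M⇝N , λ i j → trans (N≡ i j) (cong (λ p → toSign p * M i j) (∑-basis a i))
    where
    -- The induction runs over the size m of the row family, since n is fixed by M.
    familyNegated-obtainable : ∀ {m} (rows : Fin m → Fin n) (c : Fin m → Parity) →
      Σ[ N ∈ SignMatrix n ] Obtainable M N × (∀ i j → N i j ≡ toSign (∑[ k < m ] (c k ℙ.* basis (rows k) i)) * M i j)
    familyNegated-obtainable {zero}  rows c = M , ε , λ i j → refl
    familyNegated-obtainable {suc m} rows c with familyNegated-obtainable (rows ∘ suc) (c ∘ suc) | c zero
    ... | N , M⇝N , N≡ | 0ℙ = N , M⇝N , N≡
    ... | N , M⇝N , N≡ | 1ℙ = negateRow r N , M⇝N ◅◅ (rowStep r (λ _ _ → refl) ◅ ε) , λ i j → begin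
      negateRow r N i j                              ≡⟨ negateRow≡toSign* r N i j ⟩
      toSign (basis r i) * N i j                     ≡⟨ cong (toSign (basis r i) *_) (N≡ i j) ⟩
      toSign (basis r i) * (toSign (rest i) * M i j) ≡⟨ toSign-+-* (basis r i) (rest i) (M i j) ⟩
      toSign (basis r i + rest i) * M i j            ∎
      where
      r : Fin n
      r = rows zero
      rest : Fin n → Parity
      rest i = ∑[ k < m ] (c (suc k) ℙ.* basis (rows (suc k)) i)

  colsNegated-obtainable : ∀ (b : Fin n → Parity) (M : SignMatrix n) →
    Σ[ N ∈ SignMatrix n ] Obtainable M N × (∀ i j → N i j ≡ toSign (b j) * M i j)
  colsNegated-obtainable b M =
    let N , M⇝N , N≡ = rowsNegated-obtainable b (flip M)
    in  flip N , obtainable-flip M⇝N , flip N≡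

  linesNegated-obtainable : ∀ (a b : Fin n → Parity) (M : SignMatrix n) →
    Σ[ N ∈ SignMatrix n ] Obtainable M N × LinesNegated a b M N
  linesNegated-obtainable a b M =
    let L , M⇝L , L≡ = colsNegated-obtainable b M
        N , L⇝N , N≡ = rowsNegated-obtainable a L
    in  N , M⇝L ◅◅ L⇝N , linesNegated λ i j → begin
      N i j                                 ≡⟨ N≡ i j ⟩
      toSign (a i) * L i j                  ≡⟨ cong (toSign (a i) *_) (L≡ i j) ⟩
      toSign (a i) * (toSign (b j) * M i j) ≡⟨ toSign-+-* (a i) (b j) (M i j) ⟩
      toSign (a i + b j) * M i j            ∎

module _ {n : ℕ} (n-odd : parity n ≡ 1ℙ) where

  ∑-const : ∀ x → ∑[ k < n ] x ≡ x
  ∑-const x = trans (∑-replicate n x) (cong (ℙ._* x) n-odd)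

  rowParity-linesNegated : ∀ {a b} {M N : SignMatrix n} → LinesNegated a b M N →
    ∀ i → rowParity N i ≡ (a i + sum b) + rowParity M i
  rowParity-linesNegated {a} {b} {M} {N} M~N i = begin
    rowParity N i                                 ≡⟨ sum-cong-≗ entry ⟩
    ∑[ j < n ] ((a i + b j) + plusParity (M i j)) ≡⟨ ∑-distrib-+ (λ j → a i + b j) (λ j → plusParity (M i j)) ⟩
    ∑[ j < n ] (a i + b j) + rowParity M i        ≡⟨ cong (_+ rowParity M i) (∑-distrib-+ (λ _ → a i) b) ⟩
    (∑[ j < n ] a i + sum b) + rowParity M i      ≡⟨ cong (λ x → (x + sum b) + rowParity M i) (∑-const (a i)) ⟩
    (a i + sum b) + rowParity M i                 ∎
    where
    entry : ∀ j → plusParity (N i j) ≡ (a i + b j) + plusParity (M i j)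
    entry j = trans (cong plusParity (entries M~N i j)) (plusParity-toSign* (a i + b j) (M i j))

  rowsEven-linesNegated : ∀ {a b} {M N : SignMatrix n} → RowsEven M → RowsEven N → LinesNegated a b M N →
    ∀ i → a i ≡ sum b
  rowsEven-linesNegated {a} {b} {M} {N} M-even N-even M~N i = x∙y⁻¹≈ε⇒x≈y (a i) (sum b) (begin
    a i + sum b                   ≡⟨ +-identityʳ (a i + sum b) ⟨
    (a i + sum b) + 0ℙ            ≡⟨ cong ((a i + sum b) +_) (M-even i) ⟨
    (a i + sum b) + rowParity M i ≡⟨ rowParity-linesNegated M~N i ⟨
    rowParity N i                 ≡⟨ N-even i ⟩
    0ℙ                            ∎)

  linesNegated-parityNormalized : ∀ {a b} {M N : SignMatrix n} → ParityNormalized M → ParityNormalized N →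
    LinesNegated a b M N → ∀ i j → N i j ≡ M i j
  linesNegated-parityNormalized {a} {b} {M} {N} M-norm N-norm M~N i j = begin
    N i j                      ≡⟨ entries M~N i j ⟩
    toSign (a i + b j) * M i j ≡⟨ cong (λ p → toSign p * M i j) pattern-vanishes ⟩
    M i j                      ∎
    where
    M-even : RowsEven M × RowsEven (flip M)
    M-even = to (parityNormalized⇔ M) M-norm
    N-even : RowsEven N × RowsEven (flip N)
    N-even = to (parityNormalized⇔ N) N-norm
    a≡∑b : ∀ i → a i ≡ sum b
    a≡∑b = rowsEven-linesNegated (proj₁ M-even) (proj₁ N-even) M~N
    b≡∑a : ∀ j → b j ≡ sum a
    b≡∑a = rowsEven-linesNegated (proj₂ M-even) (proj₂ N-even) (linesNegated-flip M~N)
    ∑a≡∑b : sum a ≡ sum b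
    ∑a≡∑b = trans (sum-cong-≗ a≡∑b) (∑-const (sum b))
    pattern-vanishes : a i + b j ≡ 0ℙ
    pattern-vanishes = trans (cong₂ _+_ (a≡∑b i) (trans (b≡∑a j) ∑a≡∑b)) (p+p≡0ℙ (sum b))

  linesNegated-normalizes : ∀ {M N : SignMatrix n} →
    LinesNegated (rowParity M) (λ j → rowParity (flip M) j + sum (rowParity M)) M N → ParityNormalized N
  linesNegated-normalizes {M} {N} M~N = from (parityNormalized⇔ N) (rows-even , cols-even)
    where
    r c : Fin n → Parity
    r = rowParity M
    c = rowParity (flip M)
    T : Parity
    T = sum r

    ∑b≡0ℙ : sum (λ j → c j + T) ≡ 0ℙ
    ∑b≡0ℙ = begin
      sum (λ j → c j + T)  ≡⟨ ∑-distrib-+ c (λ _ → T) ⟩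
      sum c + ∑[ j < n ] T ≡⟨ cong₂ _+_ (sym (∑-comm (λ i j → plusParity (M i j)))) (∑-const T) ⟩
      T + T                ≡⟨ p+p≡0ℙ T ⟩
      0ℙ                   ∎

    rows-even : RowsEven N
    rows-even i = begin
      rowParity N i                      ≡⟨ rowParity-linesNegated M~N i ⟩
      (r i + sum (λ j → c j + T)) + r i  ≡⟨ cong (λ x → (r i + x) + r i) ∑b≡0ℙ ⟩
      (r i + 0ℙ) + r i                   ≡⟨ cong (_+ r i) (+-identityʳ (r i)) ⟩
      r i + r i                          ≡⟨ p+p≡0ℙ (r i) ⟩
      0ℙ                                 ∎

    cols-even : RowsEven (flip N)
    cols-even j = begin
      rowParity (flip N) j     ≡⟨ rowParity-linesNegated (linesNegated-flip M~N) j ⟩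
      ((c j + T) + T) + c j    ≡⟨ cong (_+ c j) (+-assoc (c j) T T) ⟩
      (c j + (T + T)) + c j    ≡⟨ cong (λ x → (c j + x) + c j) (p+p≡0ℙ T) ⟩
      (c j + 0ℙ) + c j         ≡⟨ cong (_+ c j) (+-identityʳ (c j)) ⟩
      c j + c j                ≡⟨ p+p≡0ℙ (c j) ⟩
      0ℙ                       ∎

  parityNormalized-exists : (M : SignMatrix n) → Σ[ N ∈ SignMatrix n ] Obtainable M N × ParityNormalized N
  parityNormalized-exists M =
    let N , M⇝N , M~N = linesNegated-obtainable (rowParity M) (λ j → rowParity (flip M) j + sum (rowParity M)) M
    in  N , M⇝N , linesNegated-normalizes M~N

  parityNormalized-unique : ∀ {M N₁ N₂ : SignMatrix n} → Obtainable M N₁ → ParityNormalized N₁ →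
    Obtainable M N₂ → ParityNormalized N₂ → ∀ i j → N₁ i j ≡ N₂ i j
  parityNormalized-unique M⇝N₁ N₁-norm M⇝N₂ N₂-norm i j =
    let _ , _ , M~N₁ = obtainable⇒linesNegated M⇝N₁
        _ , _ , M~N₂ = obtainable⇒linesNegated M⇝N₂
    in  sym (linesNegated-parityNormalized N₁-norm N₂-norm (linesNegated-trans (linesNegated-sym M~N₁) M~N₂) i j)

mainTheorem6 : (n : ℕ) → Odd n → (M : SignMatrix n) →
    Σ (SignMatrix n) (λ N → Obtainable M N × ParityNormalized N)
    × (∀ N₁ N₂ → Obtainable M N₁ → ParityNormalized N₁ →
         Obtainable M N₂ → ParityNormalized N₂ → ∀ i j → N₁ i j ≡ N₂ i j)
mainTheorem6 n n-odd M =
  parityNormalized-exists (odd⇒parity≡1ℙ n n-odd) M ,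
  λ _ _ → parityNormalized-unique (odd⇒parity≡1ℙ n n-odd)
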